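{- In an unweighted hypergraph $H$ with $n$ vertices, for every $w$ the number of hyperedges $e$ with $\lambda_e \le w$ is at most $(n-1)\cdot w$.
   Context: A hypergraph $H=(V,E)$ has a finite vertex set $V$ and a (multi)set $E$ of hyperedges, each a subset of $V$ with at least two vertices. For a partition of $V$ into nonempty parts $V_1,\dots,V_k$, $E[V_1,\dots,V_k]$ is the set of hyperedges not contained in any single part. $\Phi(H)=\min_{2\le k\le |V|}\min_{V_1\cup\dots\cup V_k=V}|E[V_1,\dots,V_k]|/(k-1)$ over partitions into $k$ nonempty parts. For $S\subseteq V$, $H[S]$ is the sub-hypergraph on $S$ of hyperedges contained in $S$. Strength $\lambda_e$ is defined recursively: choose a partition $V_1,\dots,V_k$ attaining $\Phi(H)$; each $e\in E[V_1,\dots,V_k]$ gets $\lambda_e=\Phi(H)$; every other hyperedge lies in some $V_i$ and gets its strength recursively computed inside $H[V_i]$. -}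

module Defs where

open import Data.Nat using (ℕ; suc; _≤_; _∸_)
open import Data.Bool using (Bool; true; false; _∧_; _∨_; not; T)
open import Data.Fin using (Fin; _≟_)
open import Data.Fin.Subset using (Subset; _∈_; ∣_∣; ⊤)
open import Data.Vec using (lookup; tabulate)
open import Data.List using (List; allFin; filter; length)
open import Data.Bool.ListAction using (any; all)
open import Data.Integer using (+_)
open import Data.Rational using (ℚ; _/_; _≤?_)
import Data.Rational as Q
open import Data.Product using (Σ; _×_)
open import Relation.Nullary.Decidable using (⌊_⌋)
open import Relation.Binary.PropositionalEquality using (_≡_)

-- An (unweighted) hypergraph on vertex set Fin n with m hyperedges
-- (indexed by Fin m, so repeated hyperedges = multiset), each having
-- at least two vertices.
record Hypergraph (n : ℕ) : Set where
  field
    m       : ℕ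
    edge    : Fin m → Subset n
    edge≥2  : ∀ e → 2 ≤ ∣ edge e ∣
open Hypergraph public

module _ {n : ℕ} where

  insideᵇ : Subset n → Subset n → Bool
  insideᵇ S A = all (λ v → not (lookup A v) ∨ lookup S v) (allFin n)

  crossesᵇ : ∀ {k} → (Fin n → Fin k) → Subset n → Bool
  crossesᵇ p A = any (λ u → any (λ v →
      lookup A u ∧ lookup A v ∧ not ⌊ p u ≟ p v ⌋) (allFin n)) (allFin n)

  -- A partition of S into k nonempty parts is given by a labelling
  -- p : Fin n → Fin k (values outside S are irrelevant) such that
  -- every label is used by some vertex of S.
  IsPartition : ∀ {k} → Subset n → (Fin n → Fin k) → Set
  IsPartition S p = ∀ i → Σ (Fin n) λ v → v ∈ S × p v ≡ i

  part : ∀ {k} → Subset n → (Fin n → Fin k) → Fin k → Subset n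
  part S p i = tabulate (λ v → lookup S v ∧ ⌊ p v ≟ i ⌋)

  crossCount : (H : Hypergraph n) → ∀ {k} → Subset n → (Fin n → Fin k) → ℕ
  crossCount H S p = length (filter
    (λ e → T? (insideᵇ S (edge H e) ∧ crossesᵇ p (edge H e)))
    (allFin (m H)))
    where
      open import Relation.Nullary using (Dec; yes; no)
      T? : (b : Bool) → Dec (T b)
      T? true  = yes _
      T? false = no (λ ())

  -- The ratio |E[V_1,…,V_k]| / (k-1), with k = 2 + j parts.
  ratio : (H : Hypergraph n) → Subset n → (j : ℕ) → (Fin n → Fin (2 Data.Nat.+ j)) → ℚ
  ratio H S j p = (+ crossCount H S p) / suc j

  IsOptimal : (H : Hypergraph n) → Subset n → (j : ℕ) → (Fin n → Fin (2 Data.Nat.+ j)) → Set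
  IsOptimal H S j p =
    IsPartition S p ×
    (∀ j' (q : Fin n → Fin (2 Data.Nat.+ j')) → IsPartition S q →
       ratio H S j p Q.≤ ratio H S j' q)

  -- λ : Fin m → ℚ is a valid outcome of the recursive strength
  -- computation on H[S] (for some choice of optimal partitions).
  -- Only the values on hyperedges contained in S are constrained.
  data IsStrength (H : Hypergraph n) (λₑ : Fin (m H) → ℚ) : Subset n → Set where
    small : ∀ {S} → ∣ S ∣ ≤ 1 → IsStrength H λₑ S
    split : ∀ {S} → 2 ≤ ∣ S ∣ → (j : ℕ) (p : Fin n → Fin (2 Data.Nat.+ j)) →
            IsOptimal H S j p →
            (∀ e → T (insideᵇ S (edge H e)) → T (crossesᵇ p (edge H e)) →
                   λₑ e ≡ ratio H S j p) →
            (∀ i → IsStrength H λₑ (part S p i)) →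
            IsStrength H λₑ S

  Strength : (H : Hypergraph n) → (Fin (m H) → ℚ) → Set
  Strength H λₑ = IsStrength H λₑ ⊤

  countLe : (H : Hypergraph n) → (Fin (m H) → ℚ) → ℚ → ℕ
  countLe H λₑ w = length (filter (λ e → λₑ e ≤? w) (allFin (m H)))

ℕ→ℚ : ℕ → ℚ
ℕ→ℚ k = (+ k) / 1

-- Induction along the recursive definition of strength. Let S be split into
-- k = j + 2 parts by the chosen partition, with ratio r = |E[V₁,…,Vₖ]| / (k - 1).
-- A hyperedge inside S either crosses the partition, and then has strength r, or lies
-- inside exactly one part. If r ≤ w the crossing hyperedges number (k - 1) r ≤ (k - 1) w,
-- otherwise none of them is light; by induction the part Vᵢ contains at most
-- (|Vᵢ| - 1) w light hyperedges; and (k - 1) + Σᵢ (|Vᵢ| - 1) = |S| - 1 because the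
-- parts are nonempty.
module Submission where

open import Defs
open import Data.Nat using (ℕ; _∸_)
open import Data.Rational using (ℚ; _≤_; _*_; 0ℚ)
open import Data.Fin using (Fin)

import Data.Nat as ℕ
import Data.Nat.Properties as ℕ
import Data.Rational as ℚ
import Data.Rational.Properties as ℚ
open import Data.Rational.Literals using (fromℤ)
open import Data.Rational.Unnormalised as ℚᵘ using (mkℚᵘ)
import Data.Rational.Unnormalised.Properties as ℚᵘ
open import Data.Bool using (Bool; true; false; _∧_; _∨_; not; T)
open import Data.Bool.Properties using (T-∧; T-≡)
open import Data.Empty using (⊥-elim)
import Data.Integer as ℤ
open import Data.Integer using (+_)
import Data.Integer.Properties as ℤ
open import Data.Fin using (zero; suc; _≟_; punchIn)
open import Data.Fin.Properties using (punchInᵢ≢i)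
open import Data.Fin.Subset using (Subset; _∈_; _⊆_; ∣_∣; ⊤; Nonempty; ⁅_⁆)
open import Data.Fin.Subset.Properties using (∈⊤; ∣⊤∣≡n; nonempty?; Empty-unique; ∣⊥∣≡0; p⊆q⇒∣p∣≤∣q∣; ∣⁅x⁆∣≡1; x∈⁅y⁆⇒x≡y)
open import Data.List as List using (allFin; filter; length)
import Data.List.Relation.Unary.All as All
import Data.List.Relation.Unary.All.Properties as All
import Data.List.Relation.Unary.Any as Any
import Data.List.Relation.Unary.Any.Properties as Any
open import Data.Product using (∃; _×_; _,_; proj₁; proj₂)
open import Data.Vec using ([]; _∷_; lookup)
open import Data.Vec.Properties using (lookup∘tabulate; []=⇒lookup; lookup⇒[]=)
open import Function using (_∘_; id; Equivalence)
open import Relation.Nullary using (Dec; yes; no; does; ¬_; contradiction)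
open import Relation.Nullary.Decidable using (⌊_⌋; toWitness; fromWitness; toWitnessFalse; fromWitnessFalse)
open import Relation.Unary using (Decidable)
open import Relation.Binary.PropositionalEquality

open import Algebra.Properties.CommutativeMonoid.Sum ℕ.+-0-commutativeMonoid
  using (sum; sum-syntax; sum-cong-≗; sum-remove; sum-replicate-zero; ∑-distrib-+; ∑-comm)
open import Algebra.Properties.CommutativeSemigroup ℕ.+-commutativeSemigroup using (x∙yz≈y∙xz)
open import Algebra.Properties.Semiring.Sum ℕ.+-*-semiring using (*-distribˡ-sum; *-distribʳ-sum)

𝟙 : Bool → ℕ
𝟙 true  = 1
𝟙 false = 0

𝟙-true : ∀ {b} → T b → 𝟙 b ≡ 1
𝟙-true {true} _ = refl

𝟙-false : ∀ {b} → ¬ T b → 𝟙 b ≡ 0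
𝟙-false {true}  ¬t = ⊥-elim (¬t _)
𝟙-false {false} _  = refl

𝟙≤1 : ∀ b → 𝟙 b ℕ.≤ 1
𝟙≤1 true  = ℕ.≤-refl
𝟙≤1 false = ℕ.z≤n

𝟙-∧ : ∀ a b → 𝟙 (a ∧ b) ≡ 𝟙 a ℕ.* 𝟙 b
𝟙-∧ true  true  = refl
𝟙-∧ true  false = refl
𝟙-∧ false _     = refl

𝟙-does-T? : ∀ {b} (d : Dec (T b)) → 𝟙 (does d) ≡ 𝟙 b
𝟙-does-T? {true}  (yes _) = refl
𝟙-does-T? {true}  (no ¬t) = ⊥-elim (¬t _)
𝟙-does-T? {false} (yes ())
𝟙-does-T? {false} (no _)  = refl

𝟙*𝟙-does≡0 : ∀ {P : Set} b (d : Dec P) → (T b → ¬ P) → 𝟙 b ℕ.* 𝟙 (does d) ≡ 0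
𝟙*𝟙-does≡0 b (no _)  _     = ℕ.*-zeroʳ (𝟙 b)
𝟙*𝟙-does≡0 b (yes p) b⇒¬p = cong (ℕ._* 1) (𝟙-false λ t → b⇒¬p t p)

∑-zero : ∀ {k} (f : Fin k → ℕ) → (∀ i → f i ≡ 0) → sum f ≡ 0
∑-zero {k} f f≡0 = trans (sum-cong-≗ f≡0) (sum-replicate-zero k)

∑-single : ∀ {k} (f : Fin k → ℕ) i → (∀ j → j ≢ i → f j ≡ 0) → sum f ≡ f i
∑-single {ℕ.suc _} f i f≡0 = begin
  sum f                              ≡⟨ sum-remove f ⟩
  f i ℕ.+ sum (f ∘ punchIn i)        ≡⟨ cong (f i ℕ.+_) (∑-zero _ (λ j → f≡0 _ (punchInᵢ≢i i j))) ⟩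
  f i ℕ.+ 0                          ≡⟨ ℕ.+-identityʳ (f i) ⟩
  f i                                ∎
  where open ≡-Reasoning

∑-mono-≤ : ∀ {k} {f g : Fin k → ℕ} → (∀ i → f i ℕ.≤ g i) → sum f ℕ.≤ sum g
∑-mono-≤ {ℕ.zero}  f≤g = ℕ.z≤n
∑-mono-≤ {ℕ.suc k} f≤g = ℕ.+-mono-≤ (f≤g zero) (∑-mono-≤ (f≤g ∘ suc))

∑-δ : ∀ {k} (j : Fin k) → ∑[ i < k ] 𝟙 ⌊ j ≟ i ⌋ ≡ 1
∑-δ {k} j = begin
  ∑[ i < k ] 𝟙 ⌊ j ≟ i ⌋  ≡⟨ ∑-single (λ i → 𝟙 ⌊ j ≟ i ⌋) j
                                (λ i i≢j → 𝟙-false (i≢j ∘ sym ∘ toWitness {a? = j ≟ i})) ⟩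
  𝟙 ⌊ j ≟ j ⌋             ≡⟨ 𝟙-true (fromWitness {a? = j ≟ j} refl) ⟩
  1                       ∎
  where open ≡-Reasoning

∑-pred : ∀ {k} (f : Fin k → ℕ) → (∀ i → 1 ℕ.≤ f i) → k ℕ.+ ∑[ i < k ] (f i ∸ 1) ≡ sum f
∑-pred {ℕ.zero}  f _   = refl
∑-pred {ℕ.suc k} f 1≤f = begin
  ℕ.suc (k ℕ.+ (f zero ∸ 1 ℕ.+ rest))   ≡⟨ cong ℕ.suc (x∙yz≈y∙xz k (f zero ∸ 1) rest) ⟩
  ℕ.suc (f zero ∸ 1) ℕ.+ (k ℕ.+ rest)   ≡⟨ cong₂ ℕ._+_ (ℕ.suc-pred (f zero) {{ℕ.>-nonZero (1≤f zero)}})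
                                                      (∑-pred (f ∘ suc) (1≤f ∘ suc)) ⟩
  f zero ℕ.+ sum (f ∘ suc)              ∎
  where
  open ≡-Reasoning
  rest = ∑[ i < k ] (f (suc i) ∸ 1)

length-filter≡∑ : ∀ {A : Set} {P : A → Set} (P? : Decidable P) {k} (f : Fin k → A) →
  length (filter P? (List.tabulate f)) ≡ ∑[ i < k ] 𝟙 (does (P? (f i)))
length-filter≡∑ P? {ℕ.zero}  f = refl
length-filter≡∑ P? {ℕ.suc k} f with does (P? (f zero))
... | true  = cong ℕ.suc (length-filter≡∑ P? (f ∘ suc))
... | false = length-filter≡∑ P? (f ∘ suc)

length-filter-T≡∑ : ∀ {k} (b : Fin k → Bool) (T? : ∀ i → Dec (T (b i))) →
  length (filter T? (allFin k)) ≡ ∑[ i < k ] 𝟙 (b i)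
length-filter-T≡∑ b T? = trans (length-filter≡∑ T? id) (sum-cong-≗ λ i → 𝟙-does-T? (T? i))

T-not∨⁺ : ∀ {a b} → (T a → T b) → T (not a ∨ b)
T-not∨⁺ {false}         _   = _
T-not∨⁺ {true}  {true}  _   = _
T-not∨⁺ {true}  {false} a⇒b = a⇒b _

T-not∨⁻ : ∀ {a b} → T (not a ∨ b) → T a → T b
T-not∨⁻ {true} t _ = t

module _ {n : ℕ} where

  T-lookup⁺ : ∀ {A : Subset n} {v} → v ∈ A → T (lookup A v)
  T-lookup⁺ v∈A = Equivalence.from T-≡ ([]=⇒lookup v∈A)

  T-lookup⁻ : ∀ {A : Subset n} {v} → T (lookup A v) → v ∈ A
  T-lookup⁻ {A} {v} t = lookup⇒[]= v A (Equivalence.to T-≡ t)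

  insideᵇ⁺ : ∀ {S A : Subset n} → A ⊆ S → T (insideᵇ S A)
  insideᵇ⁺ {S} {A} A⊆S = All.all⁻ (λ v → not (lookup A v) ∨ lookup S v)
    (All.tabulate⁺ {f = id} λ v → T-not∨⁺ (T-lookup⁺ ∘ A⊆S ∘ T-lookup⁻))

  insideᵇ⁻ : ∀ {S A : Subset n} → T (insideᵇ S A) → A ⊆ S
  insideᵇ⁻ t {v} v∈A = T-lookup⁻ (T-not∨⁻ (All.tabulate⁻ (All.all⁺ _ _ t) v) (T-lookup⁺ v∈A))

  crossesᵇ⁺ : ∀ {k} (p : Fin n → Fin k) {A : Subset n} {u v} →
    u ∈ A → v ∈ A → p u ≢ p v → T (crossesᵇ p A)
  crossesᵇ⁺ p {u = u} {v} u∈A v∈A pu≢pv =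
    Any.any⁺ _ (Any.tabulate⁺ u (Any.any⁺ _ (Any.tabulate⁺ v
      (Equivalence.from T-∧ (T-lookup⁺ u∈A ,
        Equivalence.from T-∧ (T-lookup⁺ v∈A , fromWitnessFalse pu≢pv))))))

  crossesᵇ⁻ : ∀ {k} (p : Fin n → Fin k) {A : Subset n} → T (crossesᵇ p A) →
    ∃ λ u → ∃ λ v → u ∈ A × v ∈ A × p u ≢ p v
  crossesᵇ⁻ p t with Any.tabulate⁻ (Any.any⁻ _ _ t)
  ... | u , t′ with Any.tabulate⁻ (Any.any⁻ _ _ t′)
  ... | v , t″ with Equivalence.to T-∧ t″
  ... | u∈A , t‴ with Equivalence.to T-∧ t‴
  ... | v∈A , pu≢pv = u , v , T-lookup⁻ u∈A , T-lookup⁻ v∈A , toWitnessFalse pu≢pv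

  ∈-part⁺ : ∀ {k} {S : Subset n} {p : Fin n → Fin k} {i v} → v ∈ S → p v ≡ i → v ∈ part S p i
  ∈-part⁺ {S = S} {p} {i} {v} v∈S pv≡i = T-lookup⁻ (subst T (sym (lookup∘tabulate _ v))
    (Equivalence.from T-∧ (T-lookup⁺ v∈S , fromWitness pv≡i)))

  ∈-part⁻ : ∀ {k} {S : Subset n} {p : Fin n → Fin k} {i v} → v ∈ part S p i → v ∈ S × p v ≡ i
  ∈-part⁻ {S = S} {p} {i} {v} v∈Si with Equivalence.to T-∧ (subst T (lookup∘tabulate _ v) (T-lookup⁺ v∈Si))
  ... | v∈S , pv≡i = T-lookup⁻ v∈S , toWitness pv≡i

∣∣≡∑𝟙 : ∀ {n} (S : Subset n) → ∣ S ∣ ≡ ∑[ v < n ] 𝟙 (lookup S v)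
∣∣≡∑𝟙 []          = refl
∣∣≡∑𝟙 (true ∷ S)  = cong ℕ.suc (∣∣≡∑𝟙 S)
∣∣≡∑𝟙 (false ∷ S) = ∣∣≡∑𝟙 S

1≤∣∣⇒Nonempty : ∀ {n} {A : Subset n} → 1 ℕ.≤ ∣ A ∣ → Nonempty A
1≤∣∣⇒Nonempty {n} {A} 1≤∣A∣ with nonempty? A
... | yes ne = ne
... | no ¬ne = contradiction (subst (1 ℕ.≤_) ∣A∣≡0 1≤∣A∣) λ ()
  where ∣A∣≡0 = trans (cong ∣_∣ (Empty-unique ¬ne)) (∣⊥∣≡0 n)

module _ {n k : ℕ} (S : Subset n) (p : Fin n → Fin k) where

  ∣∣≡∑∣part∣ : ∣ S ∣ ≡ ∑[ i < k ] ∣ part S p i ∣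
  ∣∣≡∑∣part∣ = begin
    ∣ S ∣                                             ≡⟨ ∣∣≡∑𝟙 S ⟩
    ∑[ v < n ] 𝟙 (lookup S v)                         ≡⟨ sum-cong-≗ vertex-in-one-part ⟩
    ∑[ v < n ] ∑[ i < k ] 𝟙 (lookup (part S p i) v)   ≡⟨ ∑-comm (λ v i → 𝟙 (lookup (part S p i) v)) ⟩
    ∑[ i < k ] ∑[ v < n ] 𝟙 (lookup (part S p i) v)   ≡⟨ sum-cong-≗ (∣∣≡∑𝟙 ∘ part S p) ⟨
    ∑[ i < k ] ∣ part S p i ∣                         ∎
    where
    open ≡-Reasoning
    vertex-in-one-part : ∀ v → 𝟙 (lookup S v) ≡ ∑[ i < k ] 𝟙 (lookup (part S p i) v)
    vertex-in-one-part v = begin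
      𝟙 (lookup S v)                                       ≡⟨ ℕ.*-identityʳ _ ⟨
      𝟙 (lookup S v) ℕ.* 1                                 ≡⟨ cong (𝟙 (lookup S v) ℕ.*_) (∑-δ (p v)) ⟨
      𝟙 (lookup S v) ℕ.* ∑[ i < k ] 𝟙 ⌊ p v ≟ i ⌋          ≡⟨ *-distribˡ-sum (𝟙 (lookup S v)) (λ i → 𝟙 ⌊ p v ≟ i ⌋) ⟩
      ∑[ i < k ] (𝟙 (lookup S v) ℕ.* 𝟙 ⌊ p v ≟ i ⌋)        ≡⟨ sum-cong-≗ (λ i → 𝟙-∧ (lookup S v) ⌊ p v ≟ i ⌋) ⟨
      ∑[ i < k ] 𝟙 (lookup S v ∧ ⌊ p v ≟ i ⌋)
        ≡⟨ sum-cong-≗ (λ i → cong 𝟙 (lookup∘tabulate (λ u → lookup S u ∧ ⌊ p u ≟ i ⌋) v)) ⟨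
      ∑[ i < k ] 𝟙 (lookup (part S p i) v)                 ∎

  part-nonempty : IsPartition S p → ∀ i → 1 ℕ.≤ ∣ part S p i ∣
  part-nonempty isPartition i with isPartition i
  ... | v , v∈S , pv≡i = subst (ℕ._≤ ∣ part S p i ∣) (∣⁅x⁆∣≡1 v) (p⊆q⇒∣p∣≤∣q∣ ⁅v⁆⊆part)
    where
    ⁅v⁆⊆part : ⁅ v ⁆ ⊆ part S p i
    ⁅v⁆⊆part x∈⁅v⁆ rewrite x∈⁅y⁆⇒x≡y v x∈⁅v⁆ = ∈-part⁺ v∈S pv≡i

  in-part : ∀ {i A v} → T (insideᵇ (part S p i) A) → v ∈ A → v ∈ S × p v ≡ i
  in-part t = ∈-part⁻ ∘ insideᵇ⁻ t

  𝟙-insideᵇ-split : ∀ {A} → Nonempty A →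
    𝟙 (insideᵇ S A) ≡ 𝟙 (insideᵇ S A ∧ crossesᵇ p A) ℕ.+ ∑[ i < k ] 𝟙 (insideᵇ (part S p i) A)
  𝟙-insideᵇ-split {A} (u , u∈A) with insideᵇ S A in inside≡ | crossesᵇ p A in crosses≡
  ... | false | _ = sym (∑-zero (λ i → 𝟙 (insideᵇ (part S p i) A)) λ i → 𝟙-false λ t →
          subst T inside≡ (insideᵇ⁺ {S = S} {A = A} (proj₁ ∘ in-part {i} {A} t)))
  ... | true | true = sym (cong ℕ.suc (∑-zero (λ i → 𝟙 (insideᵇ (part S p i) A)) λ i → 𝟙-false λ t →
          let (v , w , v∈A , w∈A , pv≢pw) = crossesᵇ⁻ p {A} (subst T (sym crosses≡) _)
          in pv≢pw (trans (proj₂ (in-part {i} {A} t v∈A)) (sym (proj₂ (in-part {i} {A} t w∈A))))))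
  ... | true | false = sym (trans (∑-single (λ i → 𝟙 (insideᵇ (part S p i) A)) (p u) other-parts)
                                  (𝟙-true (insideᵇ⁺ ⊆part-of-u)))
    where
    same-label : ∀ {v} → v ∈ A → p v ≡ p u
    same-label {v} v∈A with p v ≟ p u
    ... | yes pv≡pu = pv≡pu
    ... | no  pv≢pu = contradiction (crossesᵇ⁺ p v∈A u∈A pv≢pu) (subst T crosses≡)
    ⊆part-of-u : A ⊆ part S p (p u)
    ⊆part-of-u v∈A = ∈-part⁺ (insideᵇ⁻ {S = S} {A = A} (subst T (sym inside≡) _) v∈A) (same-label v∈A)
    other-parts : ∀ i → i ≢ p u → 𝟙 (insideᵇ (part S p i) A) ≡ 0
    other-parts i i≢pu = 𝟙-false λ t → i≢pu (sym (proj₂ (in-part {i} {A} t u∈A)))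

∣∣∸1≡∑∣part∣∸1 : ∀ {n k} (S : Subset n) (p : Fin n → Fin (ℕ.suc k)) → IsPartition S p →
  ∣ S ∣ ∸ 1 ≡ k ℕ.+ ∑[ i < ℕ.suc k ] (∣ part S p i ∣ ∸ 1)
∣∣∸1≡∑∣part∣∸1 S p isPartition =
  cong (_∸ 1) (trans (∣∣≡∑∣part∣ S p) (sym (∑-pred _ (part-nonempty S p isPartition))))

module _ {n : ℕ} (H : Hypergraph n) where

  edgesIn : (Fin (m H) → ℕ) → Subset n → ℕ
  edgesIn c S = ∑[ e < m H ] (𝟙 (insideᵇ S (edge H e)) ℕ.* c e)

  crossingEdges : ∀ {k} → (Fin (m H) → ℕ) → Subset n → (Fin n → Fin k) → ℕ
  crossingEdges c S p = ∑[ e < m H ] (𝟙 (insideᵇ S (edge H e) ∧ crossesᵇ p (edge H e)) ℕ.* c e)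

  edge-nonempty : ∀ e → Nonempty (edge H e)
  edge-nonempty e = 1≤∣∣⇒Nonempty (ℕ.≤-trans (ℕ.s≤s ℕ.z≤n) (edge≥2 H e))

  edgesIn-split : ∀ {k} (c : Fin (m H) → ℕ) (S : Subset n) (p : Fin n → Fin k) →
    edgesIn c S ≡ crossingEdges c S p ℕ.+ ∑[ i < k ] edgesIn c (part S p i)
  edgesIn-split {k} c S p = begin
    ∑[ e < m H ] (𝟙 (A⊆ S e) ℕ.* c e)
      ≡⟨ sum-cong-≗ (λ e → cong (ℕ._* c e) (𝟙-insideᵇ-split S p (edge-nonempty e))) ⟩
    ∑[ e < m H ] ((𝟙 (A⊆ S e ∧ crosses e) ℕ.+ ∑[ i < k ] 𝟙 (A⊆ (part S p i) e)) ℕ.* c e)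
      ≡⟨ sum-cong-≗ (λ e → trans (ℕ.*-distribʳ-+ (c e) (𝟙 (A⊆ S e ∧ crosses e)) _)
                             (cong (𝟙 (A⊆ S e ∧ crosses e) ℕ.* c e ℕ.+_)
                                   (*-distribʳ-sum (c e) (λ i → 𝟙 (A⊆ (part S p i) e))))) ⟩
    ∑[ e < m H ] (𝟙 (A⊆ S e ∧ crosses e) ℕ.* c e ℕ.+ ∑[ i < k ] (𝟙 (A⊆ (part S p i) e) ℕ.* c e))
      ≡⟨ ∑-distrib-+ (λ e → 𝟙 (A⊆ S e ∧ crosses e) ℕ.* c e) _ ⟩
    crossingEdges c S p ℕ.+ ∑[ e < m H ] ∑[ i < k ] (𝟙 (A⊆ (part S p i) e) ℕ.* c e)
      ≡⟨ cong (crossingEdges c S p ℕ.+_) (∑-comm (λ e i → 𝟙 (A⊆ (part S p i) e) ℕ.* c e)) ⟩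
    crossingEdges c S p ℕ.+ ∑[ i < k ] edgesIn c (part S p i) ∎
    where
    open ≡-Reasoning
    A⊆ : Subset n → Fin (m H) → Bool
    A⊆ S e = insideᵇ S (edge H e)
    crosses : Fin (m H) → Bool
    crosses e = crossesᵇ p (edge H e)

  edgesIn-small : ∀ c {S : Subset n} → ∣ S ∣ ℕ.≤ 1 → edgesIn c S ≡ 0
  edgesIn-small c {S} ∣S∣≤1 = ∑-zero _ λ e → cong (ℕ._* c e) (𝟙-false λ t →
    ℕ.≤⇒≯ (ℕ.≤-trans (p⊆q⇒∣p∣≤∣q∣ (insideᵇ⁻ {S = S} {A = edge H e} t)) ∣S∣≤1) (edge≥2 H e))

  edgesIn-⊤ : ∀ c → edgesIn c ⊤ ≡ sum c
  edgesIn-⊤ c = sum-cong-≗ λ e →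
    trans (cong (ℕ._* c e) (𝟙-true (insideᵇ⁺ {S = ⊤} {A = edge H e} λ _ → ∈⊤))) (ℕ.*-identityˡ (c e))

  crossingEdges-mono : ∀ {k c d} (S : Subset n) (p : Fin n → Fin k) → (∀ e → c e ℕ.≤ d e) →
    crossingEdges c S p ℕ.≤ crossingEdges d S p
  crossingEdges-mono S p c≤d = ∑-mono-≤ λ e →
    ℕ.*-monoʳ-≤ (𝟙 (insideᵇ S (edge H e) ∧ crossesᵇ p (edge H e))) (c≤d e)

  crossCount≡crossingEdges : ∀ {j} (S : Subset n) (p : Fin n → Fin (2 ℕ.+ j)) →
    crossCount H S p ≡ crossingEdges (λ _ → 1) S p
  crossCount≡crossingEdges S p = trans (length-filter-T≡∑ crosses _) (sum-cong-≗ λ e →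
    sym (ℕ.*-identityʳ (𝟙 (crosses e))))
    where
    crosses : Fin (m H) → Bool
    crosses e = insideᵇ S (edge H e) ∧ crossesᵇ p (edge H e)

ℕ→ℚ≡fromℤ : ∀ k → ℕ→ℚ k ≡ fromℤ (+ k)
ℕ→ℚ≡fromℤ k = ℚ.fromℚᵘ-toℚᵘ (fromℤ (+ k))

ℕ→ℚ-+ : ∀ a b → ℕ→ℚ (a ℕ.+ b) ≡ ℕ→ℚ a ℚ.+ ℕ→ℚ b
ℕ→ℚ-+ a b rewrite ℕ→ℚ≡fromℤ a | ℕ→ℚ≡fromℤ b =
  cong (ℚ._/ 1) (trans (ℤ.pos-+ a b) (sym (cong₂ ℤ._+_ (ℤ.*-identityʳ (+ a)) (ℤ.*-identityʳ (+ b)))))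

ℕ→ℚ-mono-≤ : ∀ {a b} → a ℕ.≤ b → ℕ→ℚ a ≤ ℕ→ℚ b
ℕ→ℚ-mono-≤ {a} {b} a≤b rewrite ℕ→ℚ≡fromℤ a | ℕ→ℚ≡fromℤ b =
  ℚ.*≤* (ℤ.*-monoʳ-≤-nonNeg (+ 1) (ℤ.+≤+ a≤b))

ℕ→ℚ-nonNeg : ∀ k → ℚ.NonNegative (ℕ→ℚ k)
ℕ→ℚ-nonNeg k = ℚ.nonNegative (subst (_≤ ℕ→ℚ k) (ℚ.0/n≡0 1) (ℕ→ℚ-mono-≤ {0} {k} ℕ.z≤n))

ℕ→ℚ-*-/ : ∀ c j → ℕ→ℚ (ℕ.suc j) * ((+ c) ℚ./ ℕ.suc j) ≡ ℕ→ℚ c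
ℕ→ℚ-*-/ c j = ℚ.toℚᵘ-injective (begin
  ℚ.toℚᵘ (ℕ→ℚ (ℕ.suc j) * (+ c ℚ./ ℕ.suc j))
    ≈⟨ ℚ.toℚᵘ-homo-* (ℕ→ℚ (ℕ.suc j)) (+ c ℚ./ ℕ.suc j) ⟩
  ℚ.toℚᵘ (ℕ→ℚ (ℕ.suc j)) ℚᵘ.* ℚ.toℚᵘ (+ c ℚ./ ℕ.suc j)
    ≈⟨ ℚᵘ.*-cong (ℚ.toℚᵘ-fromℚᵘ (mkℚᵘ (+ ℕ.suc j) 0)) (ℚ.toℚᵘ-fromℚᵘ (mkℚᵘ (+ c) j)) ⟩
  mkℚᵘ (+ ℕ.suc j) 0 ℚᵘ.* mkℚᵘ (+ c) j
    ≈⟨ ℚᵘ.*≡* scaled ⟩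
  mkℚᵘ (+ c) 0
    ≈⟨ ℚ.toℚᵘ-fromℚᵘ (mkℚᵘ (+ c) 0) ⟨
  ℚ.toℚᵘ (ℕ→ℚ c)
    ∎)
  where
  open ℚᵘ.≃-Reasoning
  scaled : (+ ℕ.suc j ℤ.* + c) ℤ.* + 1 ≡ + c ℤ.* + ℕ.suc (j ℕ.+ 0)
  scaled rewrite ℕ.+-identityʳ j = trans (ℤ.*-identityʳ _) (ℤ.*-comm (+ ℕ.suc j) (+ c))

module ScaledBound (w : ℚ) (0≤w : 0ℚ ≤ w) where

  -- A record rather than a synonym, so that a and b are recovered by unification
  -- instead of by unfolding ℕ→ℚ (whose normal forms involve gcd computations).
  infix 4 _≼_
  record _≼_ (a b : ℕ) : Set where
    constructor ≤⇒≼
    field ≼⇒≤ : ℕ→ℚ a ≤ ℕ→ℚ b * w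
  open _≼_ public

  0≼ : ∀ b → 0 ≼ b
  0≼ b = ≤⇒≼ (subst (_≤ ℕ→ℚ b * w) (sym (ℚ.0/n≡0 1))
    (ℚ.nonNegative⁻¹ _ {{ℚ.nonNeg*nonNeg⇒nonNeg (ℕ→ℚ b) {{ℕ→ℚ-nonNeg b}} w {{ℚ.nonNegative 0≤w}}}}))

  ≼-+ : ∀ {a b c d} → a ≼ b → c ≼ d → a ℕ.+ c ≼ b ℕ.+ d
  ≼-+ {a} {b} {c} {d} (≤⇒≼ a≤bw) (≤⇒≼ c≤dw) = ≤⇒≼ (begin
    ℕ→ℚ (a ℕ.+ c)                  ≡⟨ ℕ→ℚ-+ a c ⟩
    ℕ→ℚ a ℚ.+ ℕ→ℚ c                ≤⟨ ℚ.+-mono-≤ a≤bw c≤dw ⟩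
    ℕ→ℚ b * w ℚ.+ ℕ→ℚ d * w        ≡⟨ ℚ.*-distribʳ-+ w (ℕ→ℚ b) (ℕ→ℚ d) ⟨
    (ℕ→ℚ b ℚ.+ ℕ→ℚ d) * w          ≡⟨ cong (_* w) (ℕ→ℚ-+ b d) ⟨
    ℕ→ℚ (b ℕ.+ d) * w              ∎)
    where open ℚ.≤-Reasoning

  ≼-∑ : ∀ {k} {f g : Fin k → ℕ} → (∀ i → f i ≼ g i) → sum f ≼ sum g
  ≼-∑ {ℕ.zero}  _   = 0≼ 0
  ≼-∑ {ℕ.suc k} f≼g = ≼-+ (f≼g zero) (≼-∑ (f≼g ∘ suc))

  ≤-≼-trans : ∀ {a b c} → a ℕ.≤ b → b ≼ c → a ≼ c
  ≤-≼-trans a≤b (≤⇒≼ b≤cw) = ≤⇒≼ (ℚ.≤-trans (ℕ→ℚ-mono-≤ a≤b) b≤cw)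

  /≤⇒≼ : ∀ c j → + c ℚ./ ℕ.suc j ≤ w → c ≼ ℕ.suc j
  /≤⇒≼ c j c/j≤w = ≤⇒≼ (begin
    ℕ→ℚ c                              ≡⟨ ℕ→ℚ-*-/ c j ⟨
    ℕ→ℚ (ℕ.suc j) * (+ c ℚ./ ℕ.suc j)  ≤⟨ ℚ.*-monoˡ-≤-nonNeg (ℕ→ℚ (ℕ.suc j)) {{ℕ→ℚ-nonNeg (ℕ.suc j)}} c/j≤w ⟩
    ℕ→ℚ (ℕ.suc j) * w                  ∎)
    where open ℚ.≤-Reasoning

light : ∀ {k} → (Fin k → ℚ) → ℚ → Fin k → ℕ
light λₑ w e = 𝟙 (does (λₑ e ℚ.≤? w))

module _ {n : ℕ} (H : Hypergraph n) (λₑ : Fin (m H) → ℚ) (w : ℚ) (0≤w : 0ℚ ≤ w) where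

  open ScaledBound w 0≤w

  crossingLight-≼ : ∀ {S} j (p : Fin n → Fin (2 ℕ.+ j)) →
    (∀ e → T (insideᵇ S (edge H e)) → T (crossesᵇ p (edge H e)) → λₑ e ≡ ratio H S j p) →
    crossingEdges H (light λₑ w) S p ≼ ℕ.suc j
  -- A local helper instead of `with`: abstracting over this decision exhausts memory.
  crossingLight-≼ {S} j p λ≡ratio = by-cases (ratio H S j p ℚ.≤? w)
    where
    heavy : ¬ ratio H S j p ≤ w → ∀ e →
      𝟙 (insideᵇ S (edge H e) ∧ crossesᵇ p (edge H e)) ℕ.* light λₑ w e ≡ 0
    heavy ratio≰w e = 𝟙*𝟙-does≡0 _ (λₑ e ℚ.≤? w) λ crossing λₑ≤w →
      let (inside , crosses) = Equivalence.to T-∧ crossing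
      in ratio≰w (subst (_≤ w) (λ≡ratio e inside crosses) λₑ≤w)
    by-cases : Dec (ratio H S j p ≤ w) → crossingEdges H (light λₑ w) S p ≼ ℕ.suc j
    by-cases (yes ratio≤w) = ≤-≼-trans
      (subst (crossingEdges H (light λₑ w) S p ℕ.≤_) (sym (crossCount≡crossingEdges H S p))
             (crossingEdges-mono H S p λ e → 𝟙≤1 (does (λₑ e ℚ.≤? w))))
      (/≤⇒≼ (crossCount H S p) j ratio≤w)
    by-cases (no ratio≰w) = subst (_≼ ℕ.suc j) (sym (∑-zero _ (heavy ratio≰w))) (0≼ (ℕ.suc j))

  lightEdgesIn-≼ : ∀ {S} → IsStrength H λₑ S → edgesIn H (light λₑ w) S ≼ ∣ S ∣ ∸ 1
  lightEdgesIn-≼ {S} (small ∣S∣≤1) =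
    subst (_≼ ∣ S ∣ ∸ 1) (sym (edgesIn-small H (light λₑ w) {S} ∣S∣≤1)) (0≼ (∣ S ∣ ∸ 1))
  lightEdgesIn-≼ {S} (split _ j p (isPartition , _) λ≡ratio parts) =
    subst₂ _≼_ (sym (edgesIn-split H (light λₑ w) S p)) (sym (∣∣∸1≡∑∣part∣∸1 S p isPartition))
      (≼-+ (crossingLight-≼ {S} j p λ≡ratio) (≼-∑ λ i → lightEdgesIn-≼ {part S p i} (parts i)))

mainTheorem8 : (n : ℕ) (H : Hypergraph n) (λₑ : Fin (m H) → ℚ) →
    Strength H λₑ → (w : ℚ) → 0ℚ ≤ w →
    ℕ→ℚ (countLe H λₑ w) ≤ ℕ→ℚ (n ∸ 1) * w
mainTheorem8 n H λₑ strength w 0≤w = ≼⇒≤ {countLe H λₑ w} {n ∸ 1} bound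
  where
  open ScaledBound w 0≤w
  lightEdges≡countLe : edgesIn H (light λₑ w) ⊤ ≡ countLe H λₑ w
  lightEdges≡countLe =
    trans (edgesIn-⊤ H (light λₑ w)) (sym (length-filter≡∑ (λ e → λₑ e ℚ.≤? w) id))
  bound : countLe H λₑ w ≼ n ∸ 1
  bound = subst₂ _≼_ lightEdges≡countLe (cong (_∸ 1) (∣⊤∣≡n n))
                     (lightEdgesIn-≼ H λₑ w 0≤w strength)
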